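{- Let $G$ be a CNF formula over the variables $X\cup Y$ with $X\cap Y=\emptyset$, and let $z\in X$ be a monotone variable of $G$, i.e. all literals of $z$ occurring in clauses of $G$ have the same polarity. Then the set $\{z\}$ is redundant in $G$ (with respect to the quantified set $X$).
   Context: A point is a complete assignment to $X\cup Y$. For $Z'\subseteq X\cup Y$, a clause is a $Z'$-clause if it contains a variable of $Z'$, and a non-$Z'$-clause otherwise. A point $\boldsymbol{p}$ is a $Z'$-boundary point of $G$ if $G(\boldsymbol{p})=0$, every clause of $G$ falsified by $\boldsymbol{p}$ is a $Z'$-clause, and this property fails for every proper subset of $Z'$. A point $\boldsymbol{p}$ is a $Z'$-removable boundary point of $G$ if $\boldsymbol{p}$ is a $Z''$-boundary point for some $Z''\subseteq Z'$ and there is a clause $C$ falsified by $\boldsymbol{p}$ that is a non-$Z'$-clause and is implied by the conjunction of the $Z'$-clauses of $G$. A set $X'\subseteq X$ is redundant in $G$ (with respect to $X$) if there is no point that is an $X''$-boundary point of $G$ for some $X''\subseteq X'$ and is also an $X$-removable boundary point of $G$. -}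

module Defs where

open import Data.Nat using (ℕ)
open import Data.Bool using (Bool)
open import Data.Fin using (Fin)
open import Data.Fin.Subset using (Subset; _∈_; _∉_; _⊆_; _⊂_)
open import Data.List using (List)
open import Data.List.Relation.Unary.Any using (Any)
open import Data.List.Relation.Unary.All using (All)
import Data.List.Membership.Propositional as LM
open import Data.Product using (Σ; _×_; ∃)
open import Relation.Binary.PropositionalEquality using (_≡_)
open import Relation.Nullary using (¬_)

-- Variables are Fin n (the set X ∪ Y); X is a Subset n and Y its complement.
-- A literal: a variable together with its polarity (true = positive literal).
record Literal (n : ℕ) : Set where
  constructor lit
  field
    var : Fin n
    pol : Bool
open Literal public

Clause : ℕ → Set
Clause n = List (Literal n)

CNF : ℕ → Set
CNF n = List (Clause n)

Point : ℕ → Set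
Point n = Fin n → Bool

module _ {n : ℕ} where

  LitTrue : Point n → Literal n → Set
  LitTrue p l = p (var l) ≡ pol l

  ClauseSat : Point n → Clause n → Set
  ClauseSat p C = Any (LitTrue p) C

  Falsifies : Point n → Clause n → Set
  Falsifies p C = ¬ ClauseSat p C

  FormulaFalse : CNF n → Point n → Set
  FormulaFalse G p = Any (Falsifies p) G

  IsClauseOf : Subset n → Clause n → Set
  IsClauseOf Z C = Any (λ l → var l ∈ Z) C

  FalsifiedAreZ : CNF n → Subset n → Point n → Set
  FalsifiedAreZ G Z p = ∀ C → C LM.∈ G → Falsifies p C → IsClauseOf Z C

  BoundaryPoint : CNF n → Subset n → Point n → Set
  BoundaryPoint G Z p =
    FormulaFalse G p × FalsifiedAreZ G Z p
    × (∀ Z′ → Z′ ⊂ Z → ¬ FalsifiedAreZ G Z′ p)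

  ZClausesImply : CNF n → Subset n → Clause n → Set
  ZClausesImply G Z C =
    ∀ (q : Point n) →
      (∀ D → D LM.∈ G → IsClauseOf Z D → ClauseSat q D) → ClauseSat q C

  RemovableBoundaryPoint : CNF n → Subset n → Point n → Set
  RemovableBoundaryPoint G Z p =
    Σ (Subset n) (λ Z″ → Z″ ⊆ Z × BoundaryPoint G Z″ p)
    × Σ (Clause n) (λ C → Falsifies p C × ¬ IsClauseOf Z C × ZClausesImply G Z C)

  Redundant : CNF n → Subset n → Subset n → Set
  Redundant G X X′ =
    X′ ⊆ X ×
    ¬ (Σ (Point n) λ p → Σ (Subset n) λ X″ →
         X″ ⊆ X′ × BoundaryPoint G X″ p × RemovableBoundaryPoint G X p)

  Monotone : CNF n → Fin n → Set
  Monotone G z = Σ Bool λ b →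
    ∀ C → C LM.∈ G → ∀ l → l LM.∈ C → var l ≡ z → pol l ≡ b

-- Let z ∈ X occur in G only with polarity b, and suppose, for contradiction,
-- that p is an X″-boundary point with X″ ⊆ {z} which is also X-removable:
-- p falsifies a clause C with no variable of X that is implied by the
-- X-clauses of G.  Let q be p with z set to b.  Every clause of G satisfied
-- by p stays satisfied by q (the only literal that can change is a literal
-- of z, and those all have polarity b), and every clause falsified by p
-- contains z (it is an X″-clause), hence is satisfied by q.  So q satisfies
-- G, in particular its X-clauses, and therefore C.  But C mentions no
-- variable of X, so not z, and p agrees with q on C: p satisfies C, which
-- is absurd.
module Submission where

open import Defs
open import Data.Nat using (ℕ)
open import Data.Bool using (Bool; _≟_)
open import Data.Fin using (Fin) renaming (_≟_ to _≟ᶠ_)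
open import Data.Fin.Subset using (Subset; _∈_; _⊆_; ⁅_⁆)
open import Data.Fin.Subset.Properties using (x∈⁅y⁆⇒x≡y)
open import Data.Vec.Functional using (updateAt)
open import Data.Vec.Functional.Properties using (updateAt-updates; updateAt-minimal)
open import Data.List.Relation.Unary.Any using (any?)
import Data.List.Relation.Unary.Any as Any
import Data.List.Membership.Propositional as LM
open import Data.Product using (Σ; _×_; _,_)
open import Function using (const)
open import Relation.Binary.PropositionalEquality
  using (_≡_; _≢_; refl; sym; trans; subst)
open import Relation.Nullary using (¬_; yes; no)

module _ {n : ℕ} where

  OccursOnlyWith : CNF n → Fin n → Bool → Set
  OccursOnlyWith G z b =
    ∀ C → C LM.∈ G → ∀ l → l LM.∈ C → var l ≡ z → pol l ≡ b

  _[_≔_] : Point n → Fin n → Bool → Point n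
  p [ z ≔ b ] = updateAt p z (const b)

  sat-transfer : ∀ {p q : Point n} (C : Clause n) →
    (∀ {l} → l LM.∈ C → LitTrue p l → LitTrue q l) →
    ClauseSat p C → ClauseSat q C
  sat-transfer C keep sat with LM.find sat
  ... | l , l∈C , true = LM.lose l∈C (keep l∈C true)

  set-makes-true : ∀ p z b (l : Literal n) →
    var l ≡ z → pol l ≡ b → LitTrue (p [ z ≔ b ]) l
  set-makes-true p z b l refl pol≡b = trans (updateAt-updates z p) (sym pol≡b)

  set-elsewhere : ∀ p z b (x : Fin n) → x ≢ z → (p [ z ≔ b ]) x ≡ p x
  set-elsewhere p z b x x≢z = updateAt-minimal x z p x≢z

  set-keeps-true : ∀ p z b (l : Literal n) →
    (var l ≡ z → pol l ≡ b) → LitTrue p l → LitTrue (p [ z ≔ b ]) l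
  set-keeps-true p z b l onlyB true with var l ≟ᶠ z
  ... | yes v≡z = set-makes-true p z b l v≡z (onlyB v≡z)
  ... | no  v≢z = trans (set-elsewhere p z b (var l) v≢z) true

  set-invisible : ∀ p {X z} b (C : Clause n) → z ∈ X →
    ¬ IsClauseOf X C → ClauseSat (p [ z ≔ b ]) C → ClauseSat p C
  set-invisible p {X} {z} b C z∈X notX = sat-transfer C untouched
    where
    untouched : ∀ {l} → l LM.∈ C → LitTrue (p [ z ≔ b ]) l → LitTrue p l
    untouched {l} l∈C = trans (sym (set-elsewhere p z b (var l) v≢z))
      where
      v≢z : var l ≢ z
      v≢z v≡z = notX (LM.lose l∈C (subst (_∈ X) (sym v≡z) z∈X))

  monotone-repair : ∀ (G : CNF n) z b p → OccursOnlyWith G z b →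
    FalsifiedAreZ G ⁅ z ⁆ p → ∀ D → D LM.∈ G → ClauseSat (p [ z ≔ b ]) D
  monotone-repair G z b p onlyB falsifiedHaveZ D D∈G
    with any? (λ l → p (var l) ≟ pol l) D
  ... | yes sat = sat-transfer D
        (λ {l} l∈D → set-keeps-true p z b l (onlyB D D∈G l l∈D)) sat
  ... | no unsat with LM.find (falsifiedHaveZ D D∈G unsat)
  ...   | l , l∈D , v∈⁅z⁆ = LM.lose l∈D
          (set-makes-true p z b l v≡z (onlyB D D∈G l l∈D v≡z))
    where
    v≡z : var l ≡ z
    v≡z = x∈⁅y⁆⇒x≡y z v∈⁅z⁆

  singleton⊆ : ∀ {z} {X : Subset n} → z ∈ X → ⁅ z ⁆ ⊆ X
  singleton⊆ {z} {X} z∈X x∈⁅z⁆ = subst (_∈ X) (sym (x∈⁅y⁆⇒x≡y z x∈⁅z⁆)) z∈X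

  falsifiedAreZ-mono : ∀ {G : CNF n} {Z Z′ : Subset n} {p} →
    Z ⊆ Z′ → FalsifiedAreZ G Z p → FalsifiedAreZ G Z′ p
  falsifiedAreZ-mono Z⊆Z′ falsifiedAreZ C C∈G unsat =
    Any.map Z⊆Z′ (falsifiedAreZ C C∈G unsat)

proposition2 : (n : ℕ) (X : Subset n) (G : CNF n) (z : Fin n) →
    z ∈ X → Monotone G z → Redundant G X ⁅ z ⁆
proposition2 n X G z z∈X (b , onlyB) = singleton⊆ z∈X , noRemovableBoundary
  where
  -- p[z≔b] satisfies every clause of G, so the X-clauses force C true at
  -- p[z≔b], hence at p since C avoids X ∋ z; but p falsifies C.
  noRemovableBoundary : ¬ (Σ (Point n) λ p → Σ (Subset n) λ X″ →
    X″ ⊆ ⁅ z ⁆ × BoundaryPoint G X″ p × RemovableBoundaryPoint G X p)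
  noRemovableBoundary
    (p , X″ , X″⊆⁅z⁆ , (_ , falsifiedAreX″ , _) , _ , C , pFalsifiesC , notX , implied) =
    pFalsifiesC (set-invisible p b C z∈X notX (implied (p [ z ≔ b ]) satisfiesXClauses))
    where
    satisfiesXClauses : ∀ D → D LM.∈ G → IsClauseOf X D → ClauseSat (p [ z ≔ b ]) D
    satisfiesXClauses D D∈G _ = monotone-repair G z b p onlyB
      (falsifiedAreZ-mono X″⊆⁅z⁆ falsifiedAreX″) D D∈G
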